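{- Let $\ell$ be a positive integer. If $G$ is a finite simple graph with $\mathrm{lcc}(G)\le \ell$, then $\chi_{\mathrm{o}}(G)\le \frac{2\ell-1}{\ell}\Delta(G)+2$.
   Context: The local vertex clique cover number $\mathrm{lcc}(G)$ of a graph $G$ is the minimum $q$ such that for every vertex $v$, the neighborhood $N_G(v)$ is the union of at most $q$ cliques. An odd $k$-coloring of $G$ is a proper $k$-coloring (adjacent vertices get different colors from $\{1,\dots,k\}$) such that every vertex of positive degree has some color appearing an odd number of times on its neighborhood. The odd chromatic number $\chi_{\mathrm{o}}(G)$ is the minimum $k$ for which $G$ has an odd $k$-coloring. $\Delta(G)$ is the maximum degree. -}

module Defs where

open import Data.Nat using (ℕ; zero; suc; _+_; _*_; _∸_; _≤_; _<_; _⊔_; _%_)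
open import Data.Fin using (Fin)
open import Data.Fin.Properties using (_≟_)
open import Data.Bool using (Bool; true; false; T)
open import Data.List using (List; length; filterᵇ; map; foldr)
open import Data.List.Base using (allFin)
open import Data.Product using (Σ; ∃; ∃-syntax; _×_; _,_)
open import Relation.Binary.PropositionalEquality using (_≡_; _≢_)
open import Relation.Nullary.Decidable using (⌊_⌋)
open import Function using (_⇔_)

record Graph (n : ℕ) : Set where
  field
    adj   : Fin n → Fin n → Bool
    sym   : ∀ u v → adj u v ≡ adj v u
    irrefl : ∀ v → adj v v ≡ false
open Graph public

nbrs : ∀ {n} → Graph n → Fin n → List (Fin n)
nbrs G v = filterᵇ (adj G v) (allFin _)

deg : ∀ {n} → Graph n → Fin n → ℕ
deg G v = length (nbrs G v)

Δ : ∀ {n} → Graph n → ℕ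
Δ G = foldr _⊔_ 0 (map (deg G) (allFin _))

IsClique : ∀ {n} → Graph n → (Fin n → Bool) → Set
IsClique G C = ∀ x y → C x ≡ true → C y ≡ true → x ≢ y → adj G x y ≡ true

CoveredBy : ∀ {n q} → Graph n → Fin n → (Fin q → Fin n → Bool) → Set
CoveredBy G v Cs =
  (∀ i → IsClique G (Cs i)) ×
  (∀ u → (adj G v u ≡ true) ⇔ (∃[ i ] Cs i u ≡ true))

LccAtMost : ∀ {n : ℕ} → Graph n → ℕ → Set
LccAtMost {n} G ℓ = ∀ v → ∃[ q ] (q ≤ ℓ × Σ (Fin q → Fin n → Bool) (CoveredBy G v))

Proper : ∀ {n k} → Graph n → (Fin n → Fin k) → Set
Proper G c = ∀ u v → adj G u v ≡ true → c u ≢ c v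

colourCount : ∀ {n k} → Graph n → (Fin n → Fin k) → Fin n → Fin k → ℕ
colourCount G c v a = length (filterᵇ (λ u → ⌊ c u ≟ a ⌋) (nbrs G v))

IsOddColouring : ∀ {n k} → Graph n → (Fin n → Fin k) → Set
IsOddColouring G c =
  Proper G c ×
  (∀ v → 0 < deg G v → ∃[ a ] colourCount G c v a % 2 ≡ 1)

module Submission where

-- Induction on the number of edges.  Let z have maximum degree d, and take an odd colouring of H with the
-- edges at z removed.  Some clique Q of the cover of N(z) has at least d/ℓ vertices; fix x₀ ∈ Q and give
-- z a colour that avoids N(z) and the unique odd colour of every neighbour outside Q ∖ {x₀}: at most
-- 2d + 1 - |Q| colours are excluded.  Now only vertices of the clique Q ∪ {z} can lack an odd colour.
-- If some do, recolour an odd vertex x of that clique by a colour b missing from N(x) such that no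
-- neighbour of x has exactly b and the old colour of x as its odd colours; then every neighbour of x,
-- hence the whole clique, has an odd colour.  Taking for x a vertex with at most two odd colours if one
-- exists, and x₀ otherwise, keeps the excluded colours below 2Δ + 2 - ⌈Δ/ℓ⌉.  For ℓ = 1 every proper
-- colouring is odd.

open import Defs hiding (sym)
open import Data.Nat using (ℕ; zero; suc; _+_; _*_; _∸_; _≤_; _<_; _%_; _⊔_; z≤n; s≤s; _≤?_; >-nonZero)
open import Data.Nat.Properties hiding (_≟_)
open import Data.Nat.Tactic.RingSolver using (solve-∀)
open import Data.Nat.DivMod using ([m+n]%n≡m%n)
open import Data.Fin using (Fin; zero; suc; punchIn; fromℕ<)
open import Data.Fin.Properties using (_≟_; punchInᵢ≢i; any?; all?; ¬∀⟶∃¬)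
open import Data.Bool using (Bool; true; false; _∧_; _∨_; not; _xor_)
open import Data.Bool.Properties renaming (_≟_ to _≟ᴮ_)
  using (¬-not; not-involutive; ∨-zeroʳ; ∧-comm; ∧-identityʳ; ∧-zeroʳ; ∧-conicalˡ; ∧-conicalʳ; ∨-conicalˡ; ∨-conicalʳ;
         xor-identityʳ; xor-same; xor-assoc; xor-comm; not-distribˡ-xor)
open import Data.Product using (Σ; ∃-syntax; _×_; _,_; proj₁; proj₂)
open import Data.Empty using (⊥-elim)
open import Data.Sum using (inj₁; inj₂)
open import Data.Vec.Functional using (updateAt)
open import Data.Vec.Functional.Properties using (updateAt-updates; updateAt-minimal)
open import Function using (id; const; _⇔_; Equivalence; mk⇔)
open import Data.List using (List; []; _∷_; length; filterᵇ; tabulate; foldr; allFin)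
open import Data.List.Properties using (map-tabulate)
open import Relation.Binary.PropositionalEquality
open import Relation.Nullary using (¬_; yes; no; does)
open import Relation.Nullary.Decidable using (⌊_⌋; isYes≗does; dec-true; dec-false; toSum; _×-dec_)
open import Data.Nat.Induction using (<-wellFounded)
open import Induction.WellFounded using (module All)
open import Relation.Binary.Construct.On as On using ()
open import Level using (0ℓ)
open import Algebra.Properties.Semiring.Sum +-*-semiring
  using (sum; sum-syntax; sum-cong-≗; *-distribˡ-sum; ∑-distrib-+; ∑-comm; sum-remove; sum-replicate-zero)

true≢false : true ≢ false
true≢false ()

∨-trueʳ : ∀ a {b} → b ≡ true → a ∨ b ≡ true
∨-trueʳ a refl = ∨-zeroʳ a

𝟙 : Bool → ℕ
𝟙 true  = 1
𝟙 false = 0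

𝟙≤1 : ∀ b → 𝟙 b ≤ 1
𝟙≤1 true  = ≤-refl
𝟙≤1 false = z≤n

sum-mono-≤ : ∀ {n} {f g : Fin n → ℕ} → (∀ i → f i ≤ g i) → sum f ≤ sum g
sum-mono-≤ {zero}  f≤g = z≤n
sum-mono-≤ {suc n} f≤g = +-mono-≤ (f≤g zero) (sum-mono-≤ (λ i → f≤g (suc i)))

sum-≤-term : ∀ {n} (f : Fin n → ℕ) i → f i ≤ sum f
sum-≤-term f zero    = m≤m+n _ _
sum-≤-term f (suc i) = ≤-trans (sum-≤-term (λ j → f (suc j)) i) (m≤n+m _ _)

sum-const : ∀ n c → sum {n} (λ _ → c) ≡ n * c
sum-const zero    c = refl
sum-const (suc n) c = cong (c +_) (sum-const n c)

argmax : ∀ {n} (f : Fin n → ℕ) → Fin n → ∃[ i ] (∀ j → f j ≤ f i)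
argmax {suc zero}    f _ = zero , λ { zero → ≤-refl }
argmax {suc (suc n)} f _ with argmax (λ i → f (suc i)) zero
... | i , max with f (suc i) ≤? f zero
...   | yes le = zero  , λ { zero → ≤-refl ; (suc j) → ≤-trans (max j) le }
...   | no  gt = suc i , λ { zero → <⇒≤ (≰⇒> gt) ; (suc j) → max j }

sum-exchange : ∀ {n} (x : Fin n) {f g : Fin n → ℕ} → (∀ i → i ≢ x → f i ≡ g i) →
               sum f + g x ≡ sum g + f x
sum-exchange {suc n} x {f} {g} agree = begin
  sum f + g x                        ≡⟨ cong (_+ g x) (sum-remove {i = x} f) ⟩
  f x + sum (λ j → f (punchIn x j)) + g x
    ≡⟨ cong (λ t → f x + t + g x) (sum-cong-≗ (λ j → agree _ (punchInᵢ≢i x j))) ⟩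
  f x + sum (λ j → g (punchIn x j)) + g x ≡⟨ swap (f x) _ (g x) ⟩
  g x + sum (λ j → g (punchIn x j)) + f x ≡⟨ cong (_+ f x) (sum-remove {i = x} g) ⟨
  sum g + f x                        ∎
  where
  open ≡-Reasoning
  swap : ∀ a s b → a + s + b ≡ b + s + a
  swap = solve-∀

infix  7 _≡ᵇ_
infix  4 _≗ᵇ_
infixr 7 _⊕_

_≡ᵇ_ : ∀ {n} → Fin n → Fin n → Bool
a ≡ᵇ b = does (a ≟ b)

≡ᵇ-refl : ∀ {n} (a : Fin n) → (a ≡ᵇ a) ≡ true
≡ᵇ-refl a = dec-true (a ≟ a) refl

≢⇒≡ᵇ-false : ∀ {n} {a b : Fin n} → a ≢ b → (a ≡ᵇ b) ≡ false
≢⇒≡ᵇ-false {a = a} {b} = dec-false (a ≟ b)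

≡ᵇ-true⇒≡ : ∀ {n} (a b : Fin n) → a ≡ᵇ b ≡ true → a ≡ b
≡ᵇ-true⇒≡ a b eq with a ≟ b
... | yes a≡b = a≡b

⁅_⁆ : ∀ {n} → Fin n → Fin n → Bool
⁅ a ⁆ i = a ≡ᵇ i

_⊕_ : ∀ {n} → (Fin n → Bool) → (Fin n → Bool) → Fin n → Bool
(p ⊕ q) i = p i xor q i

anyᵇ : ∀ {n} → (Fin n → Bool) → Bool
anyᵇ {zero}  p = false
anyᵇ {suc n} p = p zero ∨ anyᵇ (λ i → p (suc i))

count : ∀ {n} → (Fin n → Bool) → ℕ
count p = sum (λ i → 𝟙 (p i))

anyᵇ-intro : ∀ {n} (p : Fin n → Bool) i → p i ≡ true → anyᵇ p ≡ true
anyᵇ-intro p zero    pi rewrite pi = refl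
anyᵇ-intro p (suc i) pi with p zero
... | true  = refl
... | false = anyᵇ-intro (λ j → p (suc j)) i pi

anyᵇ-witness : ∀ {n} (p : Fin n → Bool) → anyᵇ p ≡ true → ∃[ i ] p i ≡ true
anyᵇ-witness {suc n} p any with p zero in p0
... | true  = zero , p0
... | false = let i , pi = anyᵇ-witness (λ j → p (suc j)) any in suc i , pi

anyᵇ-false : ∀ {n} (p : Fin n → Bool) → anyᵇ p ≡ false → ∀ i → p i ≡ false
anyᵇ-false p none i with p i in pi
... | false = refl
... | true  = trans (sym (anyᵇ-intro p i pi)) none

anyᵇ-cong : ∀ {n} {p q : Fin n → Bool} → (∀ i → p i ≡ q i) → anyᵇ p ≡ anyᵇ q
anyᵇ-cong {zero}  p≗q = refl
anyᵇ-cong {suc n} p≗q = cong₂ _∨_ (p≗q zero) (anyᵇ-cong (λ i → p≗q (suc i)))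

𝟙-anyᵇ≤count : ∀ {n} (p : Fin n → Bool) → 𝟙 (anyᵇ p) ≤ count p
𝟙-anyᵇ≤count {zero}  p = z≤n
𝟙-anyᵇ≤count {suc n} p with p zero
... | true  = s≤s z≤n
... | false = 𝟙-anyᵇ≤count (λ i → p (suc i))

count-zero : ∀ {n} (p : Fin n → Bool) → (∀ i → p i ≡ false) → count p ≡ 0
count-zero {n} p none = trans (sum-cong-≗ (λ i → cong 𝟙 (none i))) (sum-replicate-zero n)

count-none : ∀ {n} (p : Fin n → Bool) → anyᵇ p ≡ false → count p ≡ 0
count-none p none = count-zero p (anyᵇ-false p none)

count-single : ∀ {n} (p : Fin n → Bool) a → p a ≡ true → (∀ i → i ≢ a → p i ≡ false) → count p ≡ 1
count-single {n} p a pa rest = sym (begin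
  1                             ≡⟨ cong 𝟙 pa ⟨
  𝟙 (p a)                       ≡⟨ cong (_+ 𝟙 (p a)) (sum-replicate-zero n) ⟨
  sum {n} (λ _ → 0) + 𝟙 (p a)   ≡⟨ sum-exchange a (λ i i≢a → cong 𝟙 (sym (rest i i≢a))) ⟩
  count p + 0                   ≡⟨ +-identityʳ _ ⟩
  count p                       ∎)
  where open ≡-Reasoning

count-⁅⁆ : ∀ {n} (a : Fin n) → count ⁅ a ⁆ ≡ 1
count-⁅⁆ a = count-single ⁅ a ⁆ a (≡ᵇ-refl a) (λ i i≢a → ≢⇒≡ᵇ-false (≢-sym i≢a))

count<n⇒false : ∀ {n} (p : Fin n → Bool) → count p < n → ∃[ i ] p i ≡ false
count<n⇒false {suc n} p lt with p zero in p0
... | false = zero , p0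
... | true  = let i , pi = count<n⇒false (λ j → p (suc j)) (≤-pred lt) in suc i , pi

count-pos⇒witness : ∀ {n} (p : Fin n → Bool) → 1 ≤ count p → ∃[ i ] p i ≡ true
count-pos⇒witness p pos with anyᵇ p in any
... | true  = anyᵇ-witness p any
... | false = ⊥-elim (1+n≰n (≤-trans pos (≤-reflexive (count-none p any))))

count-unique≤1 : ∀ {n} (p : Fin n → Bool) → (∀ i j → p i ≡ true → p j ≡ true → i ≡ j) →
                 count p ≤ 1
count-unique≤1 p unique with anyᵇ p in any
... | false = ≤-trans (≤-reflexive (count-none p any)) z≤n
... | true  = let a , pa = anyᵇ-witness p any in
  ≤-trans (sum-mono-≤ (below a pa)) (≤-reflexive (count-⁅⁆ a))
  where
  below : ∀ a → p a ≡ true → ∀ i → 𝟙 (p i) ≤ 𝟙 (⁅ a ⁆ i)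
  below a pa i with p i in pi
  ... | false = z≤n
  ... | true rewrite unique a i pa pi | ≡ᵇ-refl i = ≤-refl

count-+ : ∀ {n} (p q : Fin n → Bool) → sum (λ i → 𝟙 (p i) + 𝟙 (q i)) ≡ count p + count q
count-+ p q = ∑-distrib-+ (λ i → 𝟙 (p i)) (λ i → 𝟙 (q i))

count-∨ : ∀ {n} (p q : Fin n → Bool) → count (λ i → p i ∨ q i) ≤ count p + count q
count-∨ p q = ≤-trans (sum-mono-≤ (λ i → 𝟙-∨ (p i) (q i))) (≤-reflexive (count-+ p q))
  where
  𝟙-∨ : ∀ a b → 𝟙 (a ∨ b) ≤ 𝟙 a + 𝟙 b
  𝟙-∨ true  b = s≤s z≤n
  𝟙-∨ false b = ≤-refl

count-⊕ : ∀ {n} (p q : Fin n → Bool) → count (p ⊕ q) ≤ count p + count q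
count-⊕ p q = ≤-trans (sum-mono-≤ (λ i → 𝟙-xor (p i) (q i))) (≤-reflexive (count-+ p q))
  where
  𝟙-xor : ∀ a b → 𝟙 (a xor b) ≤ 𝟙 a + 𝟙 b
  𝟙-xor true  true  = z≤n
  𝟙-xor true  false = s≤s z≤n
  𝟙-xor false b     = ≤-refl

count-anyᵇ : ∀ {m n} (R : Fin m → Fin n → Bool) →
             count (λ b → anyᵇ (λ y → R y b)) ≤ sum (λ y → count (R y))
count-anyᵇ R =
  ≤-trans (sum-mono-≤ (λ b → 𝟙-anyᵇ≤count (λ y → R y b))) (≤-reflexive (∑-comm (λ b y → 𝟙 (R y b))))

count-covered : ∀ {m n} (p : Fin n → Bool) (Cs : Fin m → Fin n → Bool) →
  (∀ u → p u ≡ true → ∃[ i ] Cs i u ≡ true) → count p ≤ sum (λ i → count (Cs i))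
count-covered p Cs covered = ≤-trans (sum-mono-≤ at) (≤-reflexive (∑-comm (λ u i → 𝟙 (Cs i u))))
  where
  at : ∀ u → 𝟙 (p u) ≤ sum (λ i → 𝟙 (Cs i u))
  at u with p u in pu
  ... | false = z≤n
  ... | true  = let i , u∈ = covered u pu in
    ≤-trans (≤-reflexive (cong 𝟙 (sym u∈))) (sum-≤-term (λ i → 𝟙 (Cs i u)) i)

_≗ᵇ_ : ∀ {n} → (Fin n → Bool) → (Fin n → Bool) → Bool
p ≗ᵇ q = not (anyᵇ (p ⊕ q))

≗ᵇ⇒≗ : ∀ {n} (p q : Fin n → Bool) → (p ≗ᵇ q) ≡ true → ∀ i → p i ≡ q i
≗ᵇ⇒≗ p q p≗q i = xor-false (anyᵇ-false (p ⊕ q) (not-true p≗q) i)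
  where
  not-true : ∀ {b} → not b ≡ true → b ≡ false
  not-true {false} _ = refl
  xor-false : ∀ {a b} → a xor b ≡ false → a ≡ b
  xor-false {true}  {true}  _ = refl
  xor-false {false} {false} _ = refl

anyᵇ-⊕ : ∀ {n} {p q r : Fin n → Bool} → (∀ i → r i ≡ (p ⊕ q) i) → (p ≗ᵇ q) ≡ false →
         anyᵇ r ≡ true
anyᵇ-⊕ {p = p} {q} r≗p⊕q p≢q = trans (anyᵇ-cong r≗p⊕q) (not-false p≢q)
  where
  not-false : ∀ {b} → not b ≡ false → b ≡ true
  not-false {true} _ = refl

count-only≤1 : ∀ {n} (p : Fin n → Bool) → count (λ c → p ≗ᵇ ⁅ c ⁆) ≤ 1
count-only≤1 p = count-unique≤1 _ unique
  where
  unique : ∀ c c′ → (p ≗ᵇ ⁅ c ⁆) ≡ true → (p ≗ᵇ ⁅ c′ ⁆) ≡ true → c ≡ c′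
  unique c c′ only-c only-c′ = sym (≡ᵇ-true⇒≡ c′ c (begin
    c′ ≡ᵇ c  ≡⟨ ≗ᵇ⇒≗ p ⁅ c′ ⁆ only-c′ c ⟨
    p c      ≡⟨ ≗ᵇ⇒≗ p ⁅ c ⁆ only-c c ⟩
    c ≡ᵇ c   ≡⟨ ≡ᵇ-refl c ⟩
    true     ∎))
    where open ≡-Reasoning

-- Since a ≠ b, ⁅ a ⁆ ⊕ ⁅ b ⁆ is the pair {a, b}; the xor form matches the parity change of a move.
exactlyPair : ∀ {n} → (Fin n → Bool) → Fin n → Fin n → Bool
exactlyPair p a b = not (a ≡ᵇ b) ∧ (p ≗ᵇ ⁅ a ⁆ ⊕ ⁅ b ⁆)

exactlyPair-≢ : ∀ {n} (p : Fin n → Bool) a b → exactlyPair p a b ≡ true → a ≢ b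
exactlyPair-≢ p a .a pair refl = true≢false (trans (sym (∧-conicalˡ _ _ pair)) (cong not (≡ᵇ-refl a)))

exactlyPair-≗ : ∀ {n} (p : Fin n → Bool) a b → exactlyPair p a b ≡ true →
                ∀ i → p i ≡ (a ≡ᵇ i) xor (b ≡ᵇ i)
exactlyPair-≗ p a b pair = ≗ᵇ⇒≗ p (⁅ a ⁆ ⊕ ⁅ b ⁆) (∧-conicalʳ _ _ pair)

count-exactlyPair≤1 : ∀ {n} (p : Fin n → Bool) a → count (exactlyPair p a) ≤ 1
count-exactlyPair≤1 p a = count-unique≤1 _ unique
  where
  unique : ∀ b b′ → exactlyPair p a b ≡ true → exactlyPair p a b′ ≡ true → b ≡ b′
  unique b b′ pair pair′ = sym (≡ᵇ-true⇒≡ b′ b (begin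
    b′ ≡ᵇ b                    ≡⟨⟩
    false xor (b′ ≡ᵇ b)        ≡⟨ cong (_xor (b′ ≡ᵇ b)) a≢ᵇb ⟨
    (a ≡ᵇ b) xor (b′ ≡ᵇ b)     ≡⟨ exactlyPair-≗ p a b′ pair′ b ⟨
    p b                        ≡⟨ exactlyPair-≗ p a b pair b ⟩
    (a ≡ᵇ b) xor (b ≡ᵇ b)      ≡⟨ cong₂ _xor_ a≢ᵇb (≡ᵇ-refl b) ⟩
    true                       ∎))
    where
    open ≡-Reasoning
    a≢ᵇb : a ≡ᵇ b ≡ false
    a≢ᵇb = ≢⇒≡ᵇ-false (exactlyPair-≢ p a b pair)

count-exactlyPair-absent : ∀ {n} (p : Fin n → Bool) a → p a ≡ false → count (exactlyPair p a) ≡ 0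
count-exactlyPair-absent p a pa = count-zero _ (λ b → ¬-not (never b))
  where
  never : ∀ b → exactlyPair p a b ≢ true
  never b pair = true≢false (begin
    true xor false             ≡⟨ cong₂ _xor_ (≡ᵇ-refl a) (≢⇒≡ᵇ-false (≢-sym (exactlyPair-≢ p a b pair))) ⟨
    (a ≡ᵇ a) xor (b ≡ᵇ a)      ≡⟨ exactlyPair-≗ p a b pair a ⟨
    p a                        ≡⟨ pa ⟩
    false                      ∎)
    where open ≡-Reasoning

count-exactlyPair-many : ∀ {n} (p : Fin n → Bool) a → 3 ≤ count p → count (exactlyPair p a) ≡ 0
count-exactlyPair-many p a many = count-zero _ (λ b → ¬-not (never b))
  where
  never : ∀ b → exactlyPair p a b ≢ true
  never b pair = 1+n≰n (begin
    3                                ≤⟨ many ⟩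
    count p                          ≡⟨ sum-cong-≗ (λ i → cong 𝟙 (exactlyPair-≗ p a b pair i)) ⟩
    count (⁅ a ⁆ ⊕ ⁅ b ⁆)            ≤⟨ count-⊕ ⁅ a ⁆ ⁅ b ⁆ ⟩
    count ⁅ a ⁆ + count ⁅ b ⁆        ≡⟨ cong₂ _+_ (count-⁅⁆ a) (count-⁅⁆ b) ⟩
    2                                ∎)
    where open ≤-Reasoning

odd : ℕ → Bool
odd zero    = false
odd (suc n) = not (odd n)

odd-+ : ∀ m n → odd (m + n) ≡ odd m xor odd n
odd-+ zero    n = refl
odd-+ (suc m) n = trans (cong not (odd-+ m n)) (not-distribˡ-xor (odd m) (odd n))

odd-𝟙 : ∀ b → odd (𝟙 b) ≡ b
odd-𝟙 true  = refl
odd-𝟙 false = refl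

odd-+𝟙 : ∀ m b → odd (m + 𝟙 b) ≡ odd m xor b
odd-+𝟙 m b = trans (odd-+ m (𝟙 b)) (cong (odd m xor_) (odd-𝟙 b))

odd⇒%2≡1 : ∀ n → odd n ≡ true → n % 2 ≡ 1
odd⇒%2≡1 (suc zero)    _   = refl
odd⇒%2≡1 (suc (suc n)) odd-n+2 = begin
  (2 + n) % 2   ≡⟨ cong (_% 2) (+-comm 2 n) ⟩
  (n + 2) % 2   ≡⟨ [m+n]%n≡m%n n 2 ⟩
  n % 2         ≡⟨ odd⇒%2≡1 n (trans (sym (not-involutive (odd n))) odd-n+2) ⟩
  1             ∎
  where open ≡-Reasoning

module _ {n K : ℕ} (N : Fin n → Bool) (φ : Fin n → Fin K) where

  occ : Fin K → ℕ
  occ a = count (λ u → N u ∧ φ u ≡ᵇ a)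

  used : Fin K → Bool
  used a = anyᵇ (λ u → N u ∧ φ u ≡ᵇ a)

  oddColours : Fin K → Bool
  oddColours a = odd (occ a)

  private
    colours-of : ∀ u → count (λ a → N u ∧ φ u ≡ᵇ a) ≡ 𝟙 (N u)
    colours-of u with N u
    ... | true  = count-⁅⁆ (φ u)
    ... | false = count-zero {K} _ (λ _ → refl)

  ∑-occ : sum occ ≡ count N
  ∑-occ = trans (∑-comm (λ a u → 𝟙 (N u ∧ φ u ≡ᵇ a))) (sum-cong-≗ colours-of)

  unused⇒≢ : ∀ {b} → used b ≡ false → ∀ {u} → N u ≡ true → φ u ≢ b
  unused⇒≢ unused {u} Nu refl = true≢false
    (trans (sym (cong₂ _∧_ Nu (≡ᵇ-refl (φ u)))) (anyᵇ-false (λ w → N w ∧ φ w ≡ᵇ φ u) unused u))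

  count-used : count used ≤ count N
  count-used = ≤-trans (count-anyᵇ (λ u a → N u ∧ φ u ≡ᵇ a)) (≤-reflexive (sum-cong-≗ colours-of))

  -- Every used colour of even multiplicity occurs at least twice.
  count-used-odd : 2 * count used ≤ count N + count oddColours
  count-used-odd = begin
    2 * count used                    ≡⟨ *-distribˡ-sum 2 (λ a → 𝟙 (used a)) ⟩
    sum (λ a → 2 * 𝟙 (used a))       ≤⟨ sum-mono-≤ twice ⟩
    sum (λ a → occ a + 𝟙 (oddColours a)) ≡⟨ ∑-distrib-+ occ (λ a → 𝟙 (oddColours a)) ⟩
    sum occ + count oddColours        ≡⟨ cong (_+ count oddColours) ∑-occ ⟩
    count N + count oddColours        ∎
    where
    open ≤-Reasoning
    2≤m+odd : ∀ m → 1 ≤ m → 2 ≤ m + 𝟙 (odd m)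
    2≤m+odd (suc zero)    _ = ≤-refl
    2≤m+odd (suc (suc m)) _ = s≤s (s≤s z≤n)
    twice : ∀ a → 2 * 𝟙 (used a) ≤ occ a + 𝟙 (oddColours a)
    twice a with used a in used-a
    ... | false = z≤n
    ... | true  = let u , u∈a = anyᵇ-witness (λ u → N u ∧ φ u ≡ᵇ a) used-a in
      2≤m+odd (occ a) (≤-trans (≤-reflexive (cong 𝟙 (sym u∈a)))
                                (sum-≤-term (λ u → 𝟙 (N u ∧ φ u ≡ᵇ a)) u))

recolour : ∀ {n K} → (Fin n → Fin K) → Fin n → Fin K → Fin n → Fin K
recolour φ x b = updateAt φ x (const b)

recolour-self : ∀ {n K} (φ : Fin n → Fin K) x b → recolour φ x b x ≡ b
recolour-self φ x b = updateAt-updates x φ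

recolour-other : ∀ {n K} (φ : Fin n → Fin K) x b {u} → u ≢ x → recolour φ x b u ≡ φ u
recolour-other φ x b {u} u≢x = updateAt-minimal u x φ u≢x

module _ {n K : ℕ} where

  occ-cong : ∀ {N N′ : Fin n → Bool} {φ φ′ : Fin n → Fin K} → (∀ u → N u ≡ N′ u) →
             (∀ u → N u ≡ true → φ u ≡ φ′ u) → ∀ a → occ N φ a ≡ occ N′ φ′ a
  occ-cong {N} {N′} {φ} {φ′} N≗N′ agree a = sum-cong-≗ (λ u → cong 𝟙 (pointwise u))
    where
    pointwise : ∀ u → (N u ∧ φ u ≡ᵇ a) ≡ (N′ u ∧ φ′ u ≡ᵇ a)
    pointwise u rewrite sym (N≗N′ u) with N u in Nu
    ... | true  = cong (_≡ᵇ a) (agree u Nu)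
    ... | false = refl

  private
    xor-transpose : ∀ x y s t → x xor s ≡ y xor t → x ≡ y xor (s xor t)
    xor-transpose x y s t eq = begin
      x                   ≡⟨ xor-identityʳ x ⟨
      x xor false         ≡⟨ cong (x xor_) (xor-same s) ⟨
      x xor (s xor s)     ≡⟨ xor-assoc x s s ⟨
      (x xor s) xor s     ≡⟨ cong (_xor s) eq ⟩
      (y xor t) xor s     ≡⟨ xor-assoc y t s ⟩
      y xor (t xor s)     ≡⟨ cong (y xor_) (xor-comm t s) ⟩
      y xor (s xor t)     ∎
      where open ≡-Reasoning

  oddColours-recolour : ∀ (N : Fin n → Bool) (φ : Fin n → Fin K) x b → N x ≡ true →
    ∀ a → oddColours N (recolour φ x b) a ≡ (oddColours N φ ⊕ ⁅ φ x ⁆ ⊕ ⁅ b ⁆) a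
  oddColours-recolour N φ x b Nx a = xor-transpose _ (odd (occ N φ a)) (φ x ≡ᵇ a) (b ≡ᵇ a) (begin
    odd (occ N φ′ a) xor φ x ≡ᵇ a     ≡⟨ odd-+𝟙 (occ N φ′ a) _ ⟨
    odd (occ N φ′ a + 𝟙 (φ x ≡ᵇ a))   ≡⟨ cong odd exchanged ⟩
    odd (occ N φ a + 𝟙 (b ≡ᵇ a))      ≡⟨ odd-+𝟙 (occ N φ a) _ ⟩
    odd (occ N φ a) xor b ≡ᵇ a        ∎)
    where
    open ≡-Reasoning
    φ′ : Fin n → Fin K
    φ′ = recolour φ x b
    agree : ∀ u → u ≢ x → 𝟙 (N u ∧ φ′ u ≡ᵇ a) ≡ 𝟙 (N u ∧ φ u ≡ᵇ a)
    agree u u≢x = cong (λ c → 𝟙 (N u ∧ c ≡ᵇ a)) (recolour-other φ x b u≢x)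
    exchanged : occ N φ′ a + 𝟙 (φ x ≡ᵇ a) ≡ occ N φ a + 𝟙 (b ≡ᵇ a)
    exchanged = subst₂ (λ s t → occ N φ′ a + 𝟙 (s ∧ φ x ≡ᵇ a) ≡ occ N φ a + 𝟙 (s ∧ t ≡ᵇ a))
                       Nx (recolour-self φ x b) (sum-exchange x agree)

  oddColours-insert : ∀ {N N′ : Fin n → Bool} {φ φ′ : Fin n → Fin K} z → N z ≡ true → N′ z ≡ false →
    (∀ u → u ≢ z → N u ≡ N′ u) → (∀ u → u ≢ z → φ u ≡ φ′ u) →
    ∀ a → oddColours N φ a ≡ (oddColours N′ φ′ ⊕ ⁅ φ z ⁆) a
  oddColours-insert {N} {N′} {φ} {φ′} z Nz N′z N≗N′ φ≗φ′ a = begin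
    odd (occ N φ a)                  ≡⟨ cong odd (+-identityʳ (occ N φ a)) ⟨
    odd (occ N φ a + 0)              ≡⟨ cong odd exchanged ⟩
    odd (occ N′ φ′ a + 𝟙 (φ z ≡ᵇ a)) ≡⟨ odd-+𝟙 (occ N′ φ′ a) _ ⟩
    odd (occ N′ φ′ a) xor φ z ≡ᵇ a   ∎
    where
    open ≡-Reasoning
    agree : ∀ u → u ≢ z → 𝟙 (N u ∧ φ u ≡ᵇ a) ≡ 𝟙 (N′ u ∧ φ′ u ≡ᵇ a)
    agree u u≢z = cong₂ (λ s c → 𝟙 (s ∧ c ≡ᵇ a)) (N≗N′ u u≢z) (φ≗φ′ u u≢z)
    exchanged : occ N φ a + 0 ≡ occ N′ φ′ a + 𝟙 (φ z ≡ᵇ a)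
    exchanged = subst₂ (λ s t → occ N φ a + 𝟙 (t ∧ φ′ z ≡ᵇ a) ≡ occ N′ φ′ a + 𝟙 (s ∧ φ z ≡ᵇ a))
                       Nz N′z (sum-exchange z agree)

module _ {n : ℕ} where

  degree : Graph n → Fin n → ℕ
  degree H v = count (adj H v)

  edges : Graph n → ℕ
  edges H = sum (degree H)

  isolated : Graph n → Fin n → Bool
  isolated H v = not (anyᵇ (adj H v))

  oddAt : ∀ {K} → Graph n → (Fin n → Fin K) → Fin n → Bool
  oddAt H φ v = isolated H v ∨ anyᵇ (oddColours (adj H v) φ)

  oddAt-cong : ∀ {K} (H H′ : Graph n) {φ φ′ : Fin n → Fin K} y → (∀ u → adj H y u ≡ adj H′ y u) →
               (∀ u → adj H y u ≡ true → φ u ≡ φ′ u) → oddAt H φ y ≡ oddAt H′ φ′ y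
  oddAt-cong H H′ y N≗N′ agree =
    cong₂ _∨_ (cong not (anyᵇ-cong N≗N′)) (anyᵇ-cong (λ a → cong odd (occ-cong N≗N′ agree a)))

  isolate : Graph n → Fin n → Graph n
  isolate H z = record
    { adj    = λ u v → adj H u v ∧ (not (z ≡ᵇ u) ∧ not (z ≡ᵇ v))
    ; sym    = λ u v → cong₂ _∧_ (Graph.sym H u v) (∧-comm (not (z ≡ᵇ u)) _)
    ; irrefl = λ v → cong (_∧ _) (irrefl H v)
    }

  module _ (H : Graph n) (z : Fin n) where

    isolate-⊆ : ∀ u v → adj (isolate H z) u v ≡ true → adj H u v ≡ true
    isolate-⊆ u v = ∧-conicalˡ _ _

    isolate-other : ∀ u v → u ≢ z → v ≢ z → adj (isolate H z) u v ≡ adj H u v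
    isolate-other u v u≢z v≢z
      rewrite ≢⇒≡ᵇ-false (≢-sym u≢z) | ≢⇒≡ᵇ-false (≢-sym v≢z) = ∧-identityʳ (adj H u v)

    isolate-at : ∀ v → adj (isolate H z) v z ≡ false
    isolate-at v rewrite ≡ᵇ-refl z = trans (cong (adj H v z ∧_) (∧-zeroʳ _)) (∧-zeroʳ _)

    isolate-≢ : ∀ v u → adj (isolate H z) v u ≡ true → u ≢ z
    isolate-≢ v u vu refl = true≢false (trans (sym vu) (isolate-at v))

    degree-isolate : ∀ v → degree (isolate H z) v ≤ degree H v
    degree-isolate v = sum-mono-≤ (λ u → 𝟙-∧ (adj H v u) _)
      where
      𝟙-∧ : ∀ a b → 𝟙 (a ∧ b) ≤ 𝟙 a
      𝟙-∧ true  b = 𝟙≤1 b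
      𝟙-∧ false b = z≤n

    edges-isolate : 1 ≤ degree H z → edges (isolate H z) < edges H
    edges-isolate pos = begin-strict
      edges (isolate H z)                            <⟨ n<1+n _ ⟩
      suc (edges (isolate H z))                      ≡⟨ +-comm 1 _ ⟩
      edges (isolate H z) + 1                        ≡⟨ cong (edges (isolate H z) +_) (count-⁅⁆ z) ⟨
      edges (isolate H z) + count ⁅ z ⁆              ≡⟨ ∑-distrib-+ (degree (isolate H z)) _ ⟨
      sum (λ v → degree (isolate H z) v + 𝟙 (z ≡ᵇ v)) ≤⟨ sum-mono-≤ drop ⟩
      edges H                                        ∎
      where
      open ≤-Reasoning
      at-z : degree (isolate H z) z + 𝟙 (z ≡ᵇ z) ≤ degree H z
      at-z = ≤-trans (≤-reflexive (cong₂ _+_ no-edges (cong 𝟙 (≡ᵇ-refl z)))) pos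
        where
        no-edges : degree (isolate H z) z ≡ 0
        no-edges = count-zero _ (λ u → trans (Graph.sym (isolate H z) z u) (isolate-at u))
      drop : ∀ v → degree (isolate H z) v + 𝟙 (z ≡ᵇ v) ≤ degree H v
      drop v with toSum (z ≟ v)
      ... | inj₁ refl = at-z
      ... | inj₂ z≢v = subst (λ b → degree (isolate H z) v + 𝟙 b ≤ degree H v) (sym (≢⇒≡ᵇ-false z≢v))
                             (≤-trans (≤-reflexive (+-identityʳ _)) (degree-isolate v))

    lcc-isolate : ∀ {ℓ} → LccAtMost H ℓ → LccAtMost (isolate H z) ℓ
    lcc-isolate cover v =
      let q , q≤ℓ , Cs , cliques , covers = cover v
          Cs′ : Fin q → Fin n → Bool
          Cs′ i u = Cs i u ∧ adj (isolate H z) v u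
          cliques′ : ∀ i → IsClique (isolate H z) (Cs′ i)
          cliques′ i x y x∈ y∈ x≢y =
            trans (isolate-other x y (isolate-≢ v x (∧-conicalʳ (Cs i x) _ x∈))
                                     (isolate-≢ v y (∧-conicalʳ (Cs i y) _ y∈)))
                  (cliques i x y (∧-conicalˡ _ _ x∈) (∧-conicalˡ _ _ y∈) x≢y)
          covers′ : ∀ u → (adj (isolate H z) v u ≡ true) ⇔ (∃[ i ] Cs′ i u ≡ true)
          covers′ u = mk⇔
            (λ vu → let i , u∈ = Equivalence.to (covers u) (isolate-⊆ v u vu) in
                    i , cong₂ _∧_ u∈ vu)
            (λ (i , u∈) → ∧-conicalʳ (Cs i u) _ u∈)
      in q , q≤ℓ , Cs′ , cliques′ , covers′

OddColouring : ∀ {n} → ℕ → Graph n → Set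
OddColouring {n} K H = Σ (Fin n → Fin K) λ φ → Proper H φ × (∀ v → oddAt H φ v ≡ true)

recolour-proper : ∀ {n K} (H : Graph n) (φ : Fin n → Fin K) x b →
  (∀ u v → u ≢ x → v ≢ x → adj H u v ≡ true → φ u ≢ φ v) →
  (∀ v → adj H x v ≡ true → φ v ≢ b) → Proper H (recolour φ x b)
recolour-proper H φ x b away at-x u v uv with toSum (u ≟ x) | toSum (v ≟ x)
... | inj₁ refl | inj₁ refl = λ _ → true≢false (trans (sym uv) (irrefl H u))
... | inj₁ refl | inj₂ v≢x = λ same → at-x v uv (begin
  φ v               ≡⟨ recolour-other φ u b v≢x ⟨
  recolour φ u b v  ≡⟨ same ⟨
  recolour φ u b u  ≡⟨ recolour-self φ u b ⟩
  b                 ∎)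
  where open ≡-Reasoning
... | inj₂ u≢x | inj₁ refl = λ same → at-x u (trans (Graph.sym H v u) uv) (begin
  φ u               ≡⟨ recolour-other φ v b u≢x ⟨
  recolour φ v b u  ≡⟨ same ⟩
  recolour φ v b v  ≡⟨ recolour-self φ v b ⟩
  b                 ∎)
  where open ≡-Reasoning
... | inj₂ u≢x | inj₂ v≢x = λ same → away u v u≢x v≢x uv
  (trans (sym (recolour-other φ x b u≢x)) (trans same (recolour-other φ x b v≢x)))

-- Recolouring a vertex

module Move {n K : ℕ} (H : Graph n) (φ : Fin n → Fin K) (x : Fin n) where

  -- moving x to b would leave such a neighbour y without odd colours
  pairedAt : Fin n → Fin K → Bool
  pairedAt y b = adj H x y ∧ exactlyPair (oddColours (adj H y) φ) (φ x) b

  forbidden : Fin K → Bool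
  forbidden b = used (adj H x) φ b ∨ (φ x ≡ᵇ b ∨ anyᵇ (λ y → pairedAt y b))

  count-forbidden : count forbidden ≤ count (used (adj H x) φ) + (1 + sum (λ y → count (pairedAt y)))
  count-forbidden = begin
    count forbidden
      ≤⟨ count-∨ (used (adj H x) φ) _ ⟩
    count (used (adj H x) φ) + count (λ b → φ x ≡ᵇ b ∨ anyᵇ (λ y → pairedAt y b))
      ≤⟨ +-monoʳ-≤ _ (count-∨ ⁅ φ x ⁆ _) ⟩
    count (used (adj H x) φ) + (count ⁅ φ x ⁆ + count (λ b → anyᵇ (λ y → pairedAt y b)))
      ≤⟨ +-monoʳ-≤ _ (+-mono-≤ (≤-reflexive (count-⁅⁆ (φ x))) (count-anyᵇ pairedAt)) ⟩
    count (used (adj H x) φ) + (1 + sum (λ y → count (pairedAt y))) ∎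
    where open ≤-Reasoning

  -- Each neighbour forbids at most one colour, and those in Z forbid none.
  count-pairedAt : (Z : Fin n → Bool) →
    (∀ y → Z y ≡ true → count (exactlyPair (oddColours (adj H y) φ) (φ x)) ≡ 0) →
    sum (λ y → count (pairedAt y)) + count (λ y → adj H x y ∧ Z y) ≤ degree H x
  count-pairedAt Z cheap = begin
    sum (λ y → count (pairedAt y)) + count (λ y → adj H x y ∧ Z y)
      ≡⟨ ∑-distrib-+ (λ y → count (pairedAt y)) (λ y → 𝟙 (adj H x y ∧ Z y)) ⟨
    sum (λ y → count (pairedAt y) + 𝟙 (adj H x y ∧ Z y))
      ≤⟨ sum-mono-≤ at ⟩
    degree H x ∎
    where
    open ≤-Reasoning
    at : ∀ y → count (pairedAt y) + 𝟙 (adj H x y ∧ Z y) ≤ 𝟙 (adj H x y)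
    at y with adj H x y
    ... | false = ≤-reflexive (cong (_+ 0) (count-zero {K} _ (λ _ → refl)))
    ... | true with Z y in Zy
    ...   | true  = ≤-reflexive (cong (_+ 1) (cheap y Zy))
    ...   | false = ≤-trans (≤-reflexive (+-identityʳ _)) (count-exactlyPair≤1 (oddColours (adj H y) φ) (φ x))

  module _ (b : Fin K) (free : forbidden b ≡ false) where

    private
      unused : used (adj H x) φ b ≡ false
      unused = ∨-conicalˡ _ _ free
      rest : (φ x ≡ᵇ b ∨ anyᵇ (λ y → pairedAt y b)) ≡ false
      rest = ∨-conicalʳ (used (adj H x) φ b) _ free
      φx≢b : φ x ≡ᵇ b ≡ false
      φx≢b = ∨-conicalˡ (φ x ≡ᵇ b) _ rest
      unpaired : ∀ y → pairedAt y b ≡ false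
      unpaired = anyᵇ-false (λ y → pairedAt y b) (∨-conicalʳ (φ x ≡ᵇ b) _ rest)

    move-proper : Proper H φ → Proper H (recolour φ x b)
    move-proper proper = recolour-proper H φ x b (λ u v _ _ → proper u v) (λ v → unused⇒≢ (adj H x) φ unused)

    move-oddAt-neighbour : ∀ y → adj H x y ≡ true → oddAt H (recolour φ x b) y ≡ true
    move-oddAt-neighbour y xy =
      ∨-trueʳ (isolated H y) (anyᵇ-⊕ {p = p} {q = ⁅ φ x ⁆ ⊕ ⁅ b ⁆} flipped not-exactly)
      where
      p : Fin K → Bool
      p = oddColours (adj H y) φ
      flipped : ∀ a → oddColours (adj H y) (recolour φ x b) a ≡ (p ⊕ ⁅ φ x ⁆ ⊕ ⁅ b ⁆) a
      flipped = oddColours-recolour (adj H y) φ x b (trans (Graph.sym H y x) xy)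
      not-exactly : (p ≗ᵇ ⁅ φ x ⁆ ⊕ ⁅ b ⁆) ≡ false
      not-exactly = subst (λ t → not t ∧ (p ≗ᵇ ⁅ φ x ⁆ ⊕ ⁅ b ⁆) ≡ false) φx≢b
                      (subst (λ t → t ∧ exactlyPair p (φ x) b ≡ false) xy (unpaired y))

    move-oddAt-far : ∀ y → adj H x y ≡ false → oddAt H (recolour φ x b) y ≡ oddAt H φ y
    move-oddAt-far y xy = oddAt-cong H H y (λ _ → refl) (λ u yu → recolour-other φ x b (u≢x u yu))
      where
      u≢x : ∀ u → adj H y u ≡ true → u ≢ x
      u≢x u yu refl = true≢false (trans (sym yu) (trans (Graph.sym H y u) xy))

  -- Every neighbour of x becomes odd, and C ∖ {x} consists of neighbours of x.
  move-repairs : (C : Fin n → Bool) → Proper H φ → IsClique H C → C x ≡ true → oddAt H φ x ≡ true →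
    (∀ y → C y ≡ false → oddAt H φ y ≡ true) → ∀ b → forbidden b ≡ false → OddColouring K H
  move-repairs C proper clique Cx odd-x odd-outside b free = recolour φ x b , move-proper b free proper , odd-after
    where
    odd-after : ∀ y → oddAt H (recolour φ x b) y ≡ true
    odd-after y with adj H x y in xy
    ... | true  = move-oddAt-neighbour b free y xy
    ... | false = trans (move-oddAt-far b free y xy) odd-before
      where
      odd-before : oddAt H φ y ≡ true
      odd-before with C y in Cy | toSum (x ≟ y)
      ... | false | _        = odd-outside y Cy
      ... | true  | inj₁ refl = odd-x
      ... | true  | inj₂ x≢y = ⊥-elim (true≢false (trans (sym (clique x y Cx Cy x≢y)) xy))

-- Colouring z back in

module Extend {n K : ℕ} (H : Graph n) (z : Fin n) (φ : Fin n → Fin K) (S : Fin n → Bool) where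

  private
    H′ : Graph n
    H′ = isolate H z

  -- colouring z with c would leave such a neighbour y without odd colours
  onlyOddAt : Fin n → Fin K → Bool
  onlyOddAt y c = (adj H z y ∧ S y) ∧ (oddColours (adj H′ y) φ ≗ᵇ ⁅ c ⁆)

  forbidden : Fin K → Bool
  forbidden c = used (adj H z) φ c ∨ anyᵇ (λ y → onlyOddAt y c)

  count-forbidden : count forbidden ≤ degree H z + count (λ y → adj H z y ∧ S y)
  count-forbidden = begin
    count forbidden
      ≤⟨ count-∨ (used (adj H z) φ) _ ⟩
    count (used (adj H z) φ) + count (λ c → anyᵇ (λ y → onlyOddAt y c))
      ≤⟨ +-mono-≤ (count-used (adj H z) φ) (count-anyᵇ onlyOddAt) ⟩
    degree H z + sum (λ y → count (onlyOddAt y))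
      ≤⟨ +-monoʳ-≤ (degree H z) (sum-mono-≤ at) ⟩
    degree H z + count (λ y → adj H z y ∧ S y) ∎
    where
    open ≤-Reasoning
    at : ∀ y → count (onlyOddAt y) ≤ 𝟙 (adj H z y ∧ S y)
    at y with adj H z y ∧ S y
    ... | true  = count-only≤1 (oddColours (adj H′ y) φ)
    ... | false = ≤-reflexive (count-zero {K} _ (λ _ → refl))

  module _ (c : Fin K) (free : forbidden c ≡ false) where

    extend-proper : Proper H′ φ → Proper H (recolour φ z c)
    extend-proper proper = recolour-proper H φ z c
      (λ u v u≢z v≢z uv → proper u v (trans (isolate-other H z u v u≢z v≢z) uv))
      (λ v → unused⇒≢ (adj H z) φ (∨-conicalˡ _ _ free))

    extend-oddAt-far : ∀ y → y ≢ z → adj H z y ≡ false → oddAt H (recolour φ z c) y ≡ oddAt H′ φ y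
    extend-oddAt-far y y≢z zy = oddAt-cong H H′ y same-nbrs (λ u yu → recolour-other φ z c (u≢z u yu))
      where
      yz : adj H y z ≡ false
      yz = trans (Graph.sym H y z) zy
      u≢z : ∀ u → adj H y u ≡ true → u ≢ z
      u≢z u yu refl = true≢false (trans (sym yu) yz)
      same-nbrs : ∀ u → adj H y u ≡ adj H′ y u
      same-nbrs u with toSum (u ≟ z)
      ... | inj₁ refl = trans yz (sym (isolate-at H z y))
      ... | inj₂ u≢z′ = sym (isolate-other H z y u y≢z u≢z′)

    extend-oddAt-near : ∀ y → adj H z y ≡ true → S y ≡ true → oddAt H (recolour φ z c) y ≡ true
    extend-oddAt-near y zy Sy = ∨-trueʳ (isolated H y) (anyᵇ-⊕ {p = p} {q = ⁅ c ⁆} flipped not-only)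
      where
      p : Fin K → Bool
      p = oddColours (adj H′ y) φ
      y≢z : y ≢ z
      y≢z refl = true≢false (trans (sym zy) (irrefl H y))
      flipped : ∀ a → oddColours (adj H y) (recolour φ z c) a ≡ (p ⊕ ⁅ c ⁆) a
      flipped a = trans
        (oddColours-insert z (trans (Graph.sym H y z) zy) (isolate-at H z y)
           (λ u u≢z → sym (isolate-other H z y u y≢z u≢z)) (λ u u≢z → recolour-other φ z c u≢z) a)
        (cong (λ t → p a xor t ≡ᵇ a) (recolour-self φ z c))
      not-only : (p ≗ᵇ ⁅ c ⁆) ≡ false
      not-only = subst (λ t → t ∧ (p ≗ᵇ ⁅ c ⁆) ≡ false) (cong₂ _∧_ zy Sy)
                   (anyᵇ-false (λ y → onlyOddAt y c) (∨-conicalʳ (used (adj H z) φ c) _ free) y)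

neighbourhood-clique⇒oddAt : ∀ {n K} (H : Graph n) (φ : Fin n → Fin K) v →
  IsClique H (adj H v) → Proper H φ → oddAt H φ v ≡ true
neighbourhood-clique⇒oddAt H φ v clique proper with anyᵇ (adj H v) in nonisolated
... | false = refl
... | true  = let u , vu = anyᵇ-witness (adj H v) nonisolated in
  anyᵇ-intro (oddColours (adj H v) φ) (φ u)
    (cong odd (count-single _ u (cong₂ _∧_ vu (≡ᵇ-refl (φ u))) (only-at-u u vu)))
  where
  only-at-u : ∀ u → adj H v u ≡ true → ∀ w → w ≢ u → (adj H v w ∧ φ w ≡ᵇ φ u) ≡ false
  only-at-u u vu w w≢u with adj H v w in vw
  ... | false = refl
  ... | true  = ≢⇒≡ᵇ-false (proper w u (clique w u vw vu w≢u))

Fin≤1-irrelevant : ∀ {q} → q ≤ 1 → (i j : Fin q) → i ≡ j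
Fin≤1-irrelevant {suc zero}    _          zero zero = refl
Fin≤1-irrelevant {suc (suc _)} (s≤s ()) _    _

lcc≤1⇒neighbourhood-clique : ∀ {n} (H : Graph n) → LccAtMost H 1 → ∀ v → IsClique H (adj H v)
lcc≤1⇒neighbourhood-clique H cover v x y vx vy x≢y =
  let q , q≤1 , Cs , cliques , covers = cover v
      i , x∈ = Equivalence.to (covers x) vx
      j , y∈ = Equivalence.to (covers y) vy
  in cliques j x y (subst (λ k → Cs k x ≡ true) (Fin≤1-irrelevant q≤1 i j) x∈) y∈ x≢y

record LargeClique {n} (H : Graph n) (z : Fin n) (ℓ : ℕ) : Set where
  field
    Q        : Fin n → Bool
    Q-clique : IsClique H Q
    Q⊆N      : ∀ y → Q y ≡ true → adj H z y ≡ true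
    d≤ℓ|Q|   : degree H z ≤ ℓ * count Q

large-clique : ∀ {n ℓ} (H : Graph n) z → LccAtMost H ℓ → 1 ≤ degree H z → LargeClique H z ℓ
large-clique {n} {ℓ} H z cover pos with cover z
... | zero , _ , Cs , _ , covers =
  ⊥-elim (1+n≰n (≤-trans pos (count-covered (adj H z) Cs (λ u → Equivalence.to (covers u)))))
... | suc q , q<ℓ , Cs , cliques , covers =
  let i , largest = argmax (λ j → count (Cs j)) zero in record
    { Q        = Cs i
    ; Q-clique = cliques i
    ; Q⊆N      = λ y y∈ → Equivalence.from (covers y) (i , y∈)
    ; d≤ℓ|Q|   = begin
        degree H z                    ≤⟨ count-covered (adj H z) Cs (λ u → Equivalence.to (covers u)) ⟩
        ∑[ j < suc q ] count (Cs j)   ≤⟨ sum-mono-≤ largest ⟩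
        ∑[ j < suc q ] count (Cs i)   ≡⟨ sum-const (suc q) _ ⟩
        suc q * count (Cs i)          ≤⟨ *-monoˡ-≤ _ q<ℓ ⟩
        ℓ * count (Cs i)              ∎
    }
  where open ≤-Reasoning

-- Counting colours

-- N(z) carries at most d colours, and each of the at most d + 1 - q protected neighbours of z
-- (those outside a clique of size q, plus one inside it) forbids one more.
Budget : ℕ → ℕ → ℕ → Set
Budget ℓ K d = ∀ q → d ≤ ℓ * q → d + d + 2 ≤ K + q

budget-mono : ∀ {ℓ K d d′} → 1 ≤ ℓ → d′ ≤ d → Budget ℓ K d → Budget ℓ K d′
budget-mono {ℓ} {K} {d′ = d′} ℓ≥1 d′≤d budget q d′≤ℓq with m≤n⇒∃[o]m+o≡n d′≤d
... | e , refl = +-cancelʳ-≤ e _ _ (begin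
  d′ + d′ + 2 + e              ≤⟨ m≤m+n _ e ⟩
  d′ + d′ + 2 + e + e          ≡⟨ regroup d′ e ⟩
  d′ + e + (d′ + e) + 2        ≤⟨ budget (q + e) d+e≤ℓ[q+e] ⟩
  K + (q + e)                  ≡⟨ +-assoc K q e ⟨
  K + q + e                    ∎)
  where
  open ≤-Reasoning
  regroup : ∀ d e → d + d + 2 + e + e ≡ d + e + (d + e) + 2
  regroup = solve-∀
  d+e≤ℓ[q+e] : d′ + e ≤ ℓ * (q + e)
  d+e≤ℓ[q+e] = ≤-trans (+-mono-≤ d′≤ℓq (m≤n*m e ℓ {{>-nonZero ℓ≥1}}))
                       (≤-reflexive (sym (*-distribˡ-+ ℓ q e)))

budget⇒2≤K : ∀ {ℓ K d} → 1 ≤ ℓ → Budget ℓ K d → 2 ≤ K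
budget⇒2≤K {ℓ} {K} {d} ℓ≥1 budget = +-cancelʳ-≤ d 2 K (begin
  2 + d           ≡⟨ +-comm 2 d ⟩
  d + 2           ≤⟨ +-monoˡ-≤ 2 (m≤n+m d d) ⟩
  d + d + 2       ≤⟨ budget d (m≤n*m d ℓ {{>-nonZero ℓ≥1}}) ⟩
  K + d           ∎)
  where open ≤-Reasoning

below-budget : ∀ {c q d K} → c + q ≤ d + d + 1 → d + d + 2 ≤ K + q → c < K
below-budget {c} {q} {d} {K} c+q≤ budget =
  +-cancelʳ-< q c K (≤-trans (s≤s c+q≤) (≤-trans (≤-reflexive (sym (+-suc (d + d) 1))) budget))

half : ∀ d → ∃[ q ] (d ≤ 2 * q × 2 * q ≤ suc d)
half zero          = 0 , z≤n , z≤n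
half (suc zero)    = 1 , s≤s z≤n , ≤-refl
half (suc (suc d)) = let q , lo , hi = half d in
  suc q , ≤-trans (s≤s (s≤s lo)) (≤-reflexive (double-suc q))
        , ≤-trans (≤-reflexive (sym (double-suc q))) (s≤s (s≤s hi))
  where
  double-suc : ∀ q → 2 + 2 * q ≡ 2 * suc q
  double-suc = solve-∀

budget⇒3d+3≤2K : ∀ {ℓ K d} → 2 ≤ ℓ → Budget ℓ K d → 3 * d + 3 ≤ 2 * K
budget⇒3d+3≤2K {ℓ} {K} {d} ℓ≥2 budget = let q , d≤2q , 2q≤d+1 = half d in
  +-cancelʳ-≤ (suc d) _ _ (begin
    3 * d + 3 + suc d   ≡⟨ regroup d ⟩
    2 * (d + d + 2)     ≤⟨ *-monoʳ-≤ 2 (budget q (≤-trans d≤2q (*-monoˡ-≤ q ℓ≥2))) ⟩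
    2 * (K + q)         ≡⟨ *-distribˡ-+ 2 K q ⟩
    2 * K + 2 * q       ≤⟨ +-monoʳ-≤ (2 * K) 2q≤d+1 ⟩
    2 * K + suc d       ∎)
  where
  open ≤-Reasoning
  regroup : ∀ d → 3 * d + 3 + suc d ≡ 2 * (d + d + 2)
  regroup = solve-∀

cost-few : ∀ {c P T O d′ d K} → c ≤ P + (1 + T) → 2 * P ≤ d′ + O → O ≤ 2 → T + 1 ≤ d′ → d′ ≤ d →
           3 * d + 3 ≤ 2 * K → c < K
cost-few {c} {P} {T} {O} {d′} {d} {K} c≤ 2P≤ O≤2 T+1≤d′ d′≤d 3d+3≤2K = *-cancelˡ-< 2 c K (begin-strict
  2 * c                      ≤⟨ *-monoʳ-≤ 2 c≤ ⟩
  2 * (P + (1 + T))          ≡⟨ *-distribˡ-+ 2 P (1 + T) ⟩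
  2 * P + 2 * (1 + T)        ≤⟨ +-mono-≤ 2P≤ (*-monoʳ-≤ 2 (≤-trans (≤-reflexive (+-comm 1 T)) T+1≤d′)) ⟩
  d′ + O + 2 * d′            ≤⟨ +-monoˡ-≤ (2 * d′) (+-monoʳ-≤ d′ O≤2) ⟩
  d′ + 2 + 2 * d′            <⟨ ≤-reflexive (regroup d′) ⟩
  3 * d′ + 3                 ≤⟨ +-monoˡ-≤ 3 (*-monoʳ-≤ 3 d′≤d) ⟩
  3 * d + 3                  ≤⟨ 3d+3≤2K ⟩
  2 * K                      ∎)
  where
  open ≤-Reasoning
  regroup : ∀ d → suc (d + 2 + 2 * d) ≡ 3 * d + 3
  regroup = solve-∀

least-multiple : ∀ ℓ D → 1 ≤ ℓ → ∃[ s ] (D ≤ ℓ * s × (∀ q → D ≤ ℓ * q → s ≤ q))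
least-multiple ℓ zero    ℓ≥1 = 0 , z≤n , λ _ _ → z≤n
least-multiple ℓ (suc D) ℓ≥1 with least-multiple ℓ D ℓ≥1
... | s , D≤ℓs , least with suc D ≤? ℓ * s
...   | yes D<ℓs = s , D<ℓs , λ q D<ℓq → least q (<⇒≤ D<ℓq)
...   | no  D≮ℓs = suc s , ≤-trans (+-mono-≤ ℓ≥1 D≤ℓs) (≤-reflexive (sym (*-suc ℓ s))) , least′
  where
  least′ : ∀ q → suc D ≤ ℓ * q → suc s ≤ q
  least′ q D<ℓq with m≤n⇒m<n∨m≡n (least q (<⇒≤ D<ℓq))
  ... | inj₁ s<q  = s<q
  ... | inj₂ refl = ⊥-elim (D≮ℓs D<ℓq)

module _ {ℓ D s : ℕ} (ℓ≥1 : 1 ≤ ℓ) (D≤ℓs : D ≤ ℓ * s) (least : ∀ q → D ≤ ℓ * q → s ≤ q) where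

  private
    s≤2D+2 : s ≤ D + D + 2
    s≤2D+2 = ≤-trans (least D (m≤n*m D ℓ {{>-nonZero ℓ≥1}})) (≤-trans (m≤m+n D D) (m≤m+n (D + D) 2))

  initial-budget : Budget ℓ (D + D + 2 ∸ s) D
  initial-budget q D≤ℓq = begin
    D + D + 2                ≡⟨ m∸n+n≡m s≤2D+2 ⟨
    D + D + 2 ∸ s + s        ≤⟨ +-monoʳ-≤ _ (least q D≤ℓq) ⟩
    D + D + 2 ∸ s + q        ∎
    where open ≤-Reasoning

  colour-bound : ℓ * (D + D + 2 ∸ s) ≤ (2 * ℓ ∸ 1) * D + 2 * ℓ
  colour-bound = +-cancelʳ-≤ D _ _ (begin
    ℓ * K + D                    ≤⟨ +-monoʳ-≤ (ℓ * K) D≤ℓs ⟩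
    ℓ * K + ℓ * s                ≡⟨ *-distribˡ-+ ℓ K s ⟨
    ℓ * (K + s)                  ≡⟨ cong (ℓ *_) (m∸n+n≡m s≤2D+2) ⟩
    ℓ * (D + D + 2)              ≡⟨ expand ℓ D ⟩
    (2 * ℓ) * D + 2 * ℓ          ≡⟨ cong (λ t → t * D + 2 * ℓ) (m∸n+n≡m 1≤2ℓ) ⟨
    (2 * ℓ ∸ 1 + 1) * D + 2 * ℓ  ≡⟨ split (2 * ℓ ∸ 1) D ℓ ⟩
    (2 * ℓ ∸ 1) * D + 2 * ℓ + D  ∎)
    where
    open ≤-Reasoning
    K : ℕ
    K = D + D + 2 ∸ s
    1≤2ℓ : 1 ≤ 2 * ℓ
    1≤2ℓ = ≤-trans ℓ≥1 (m≤m+n ℓ _)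
    expand : ∀ ℓ D → ℓ * (D + D + 2) ≡ (2 * ℓ) * D + 2 * ℓ
    expand = solve-∀
    split : ∀ t D ℓ → (t + 1) * D + 2 * ℓ ≡ t * D + 2 * ℓ + D
    split = solve-∀

module Step {n K ℓ : ℕ} (H : Graph n) (z : Fin n) (cover : LccAtMost H ℓ) (ℓ≥1 : 1 ≤ ℓ)
  (maximum : ∀ v → degree H v ≤ degree H z) (nonisolated : 1 ≤ degree H z)
  (budget : Budget ℓ K (degree H z)) (φ′ : Fin n → Fin K) (proper′ : Proper (isolate H z) φ′)
  (odd′ : ∀ v → oddAt (isolate H z) φ′ v ≡ true) where

  private
    d : ℕ
    d = degree H z

  open LargeClique (large-clique H z cover nonisolated)

  x₀-exists : ∃[ x ] Q x ≡ true
  x₀-exists = count-pos⇒witness Q (nonempty (count Q) d≤ℓ|Q|)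
    where
    nonempty : ∀ q → d ≤ ℓ * q → 1 ≤ q
    nonempty zero    le = ⊥-elim (1+n≰n (≤-trans nonisolated (≤-trans le (≤-reflexive (*-zeroʳ ℓ)))))
    nonempty (suc q) _  = s≤s z≤n

  x₀ : Fin n
  x₀ = proj₁ x₀-exists

  Qx₀ : Q x₀ ≡ true
  Qx₀ = proj₂ x₀-exists

  -- the neighbours of z that are to be odd once z is coloured
  S : Fin n → Bool
  S y = not (Q y) ∨ x₀ ≡ᵇ y

  count-S : count (λ y → adj H z y ∧ S y) + count Q ≤ d + 1
  count-S = begin
    count (λ y → adj H z y ∧ S y) + count Q        ≡⟨ count-+ (λ y → adj H z y ∧ S y) Q ⟨
    sum (λ y → 𝟙 (adj H z y ∧ S y) + 𝟙 (Q y))      ≤⟨ sum-mono-≤ at ⟩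
    sum (λ y → 𝟙 (adj H z y) + 𝟙 (x₀ ≡ᵇ y))        ≡⟨ count-+ (adj H z) ⁅ x₀ ⁆ ⟩
    d + count ⁅ x₀ ⁆                                ≡⟨ cong (d +_) (count-⁅⁆ x₀) ⟩
    d + 1                                          ∎
    where
    open ≤-Reasoning
    at : ∀ y → 𝟙 (adj H z y ∧ S y) + 𝟙 (Q y) ≤ 𝟙 (adj H z y) + 𝟙 (x₀ ≡ᵇ y)
    at y with Q y in Qy
    ... | true rewrite Q⊆N y Qy = ≤-reflexive (+-comm (𝟙 (x₀ ≡ᵇ y)) 1)
    ... | false = ≤-trans (≤-reflexive (trans (+-identityʳ _) (cong 𝟙 (∧-identityʳ _)))) (m≤m+n _ _)

  private
    colour-for-z : ∃[ c ] Extend.forbidden H z φ′ S c ≡ false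
    colour-for-z = count<n⇒false (Extend.forbidden H z φ′ S) (below-budget {d = d} cost (budget (count Q) d≤ℓ|Q|))
      where
      open ≤-Reasoning
      cost : count (Extend.forbidden H z φ′ S) + count Q ≤ d + d + 1
      cost = begin
        count (Extend.forbidden H z φ′ S) + count Q       ≤⟨ +-monoˡ-≤ _ (Extend.count-forbidden H z φ′ S) ⟩
        d + count (λ y → adj H z y ∧ S y) + count Q       ≡⟨ +-assoc d _ _ ⟩
        d + (count (λ y → adj H z y ∧ S y) + count Q)     ≤⟨ +-monoʳ-≤ d count-S ⟩
        d + (d + 1)                                       ≡⟨ +-assoc d d 1 ⟨
        d + d + 1                                         ∎

  open Extend H z φ′ S using (extend-proper; extend-oddAt-near; extend-oddAt-far)

  c : Fin K
  c = proj₁ colour-for-z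

  private
    c-free : Extend.forbidden H z φ′ S c ≡ false
    c-free = proj₂ colour-for-z

  φ : Fin n → Fin K
  φ = recolour φ′ z c

  proper : Proper H φ
  proper = extend-proper c c-free proper′

  private
    z≢y : ∀ {y} → adj H z y ≡ true → z ≢ y
    z≢y zy refl = true≢false (trans (sym zy) (irrefl H z))

  -- the only vertices that may fail to be odd under φ
  C : Fin n → Bool
  C y = Q y ∨ z ≡ᵇ y

  C-clique : IsClique H C
  C-clique u v Cu Cv u≢v with Q u in Qu | Q v in Qv
  ... | true  | true  = Q-clique u v Qu Qv u≢v
  ... | true  | false =
    subst (λ t → adj H u t ≡ true) (≡ᵇ-true⇒≡ z v Cv) (trans (Graph.sym H u z) (Q⊆N u Qu))
  ... | false | true  = subst (λ t → adj H t v ≡ true) (≡ᵇ-true⇒≡ z u Cu) (Q⊆N v Qv)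
  ... | false | false = ⊥-elim (u≢v (trans (sym (≡ᵇ-true⇒≡ z u Cu)) (≡ᵇ-true⇒≡ z v Cv)))

  odd-outside : ∀ y → C y ≡ false → oddAt H φ y ≡ true
  odd-outside y Cy with adj H z y in zy
  ... | true  = extend-oddAt-near c c-free y zy (cong (λ t → not t ∨ x₀ ≡ᵇ y) (∨-conicalˡ (Q y) _ Cy))
  ... | false = trans (extend-oddAt-far c c-free y y≢z zy) (odd′ y)
    where
    y≢z : y ≢ z
    y≢z refl = true≢false (trans (sym (≡ᵇ-refl y)) (∨-conicalʳ (Q y) _ Cy))

  odd-x₀ : oddAt H φ x₀ ≡ true
  odd-x₀ = extend-oddAt-near c c-free x₀ (Q⊆N x₀ Qx₀) (∨-trueʳ (not (Q x₀)) (≡ᵇ-refl x₀))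

  oddCount : Fin n → ℕ
  oddCount w = count (oddColours (adj H w) φ)

  no-odd-colour : ∀ y → oddAt H φ y ≡ false → ∀ a → oddColours (adj H y) φ a ≡ false
  no-odd-colour y bad = anyᵇ-false (oddColours (adj H y) φ) (∨-conicalʳ (isolated H y) _ bad)

  Cx₀ : C x₀ ≡ true
  Cx₀ = cong (_∨ z ≡ᵇ x₀) Qx₀

  N∩C : Fin n → Bool
  N∩C y = adj H x₀ y ∧ C y

  -- C ∖ {x₀} lies in N(x₀) and has count Q elements (z replaces x₀).
  Q≤N∩C : count Q ≤ count N∩C
  Q≤N∩C = +-cancelʳ-≤ 1 (count Q) (count N∩C) (begin
    count Q + 1                                    ≡⟨ cong (count Q +_) (count-⁅⁆ z) ⟨
    count Q + count ⁅ z ⁆                          ≡⟨ count-+ Q ⁅ z ⁆ ⟨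
    sum (λ y → 𝟙 (Q y) + 𝟙 (z ≡ᵇ y))               ≤⟨ sum-mono-≤ at ⟩
    sum (λ y → 𝟙 (adj H x₀ y ∧ C y) + 𝟙 (x₀ ≡ᵇ y)) ≡⟨ count-+ N∩C ⁅ x₀ ⁆ ⟩
    count N∩C + count ⁅ x₀ ⁆                       ≡⟨ cong (count N∩C +_) (count-⁅⁆ x₀) ⟩
    count N∩C + 1                                  ∎)
    where
    open ≤-Reasoning
    at : ∀ y → 𝟙 (Q y) + 𝟙 (z ≡ᵇ y) ≤ 𝟙 (adj H x₀ y ∧ C y) + 𝟙 (x₀ ≡ᵇ y)
    at y with Q y in Qy
    at y | true rewrite ≢⇒≡ᵇ-false (z≢y (Q⊆N y Qy)) with toSum (x₀ ≟ y)
    ... | inj₁ x₀≡y rewrite dec-true (x₀ ≟ y) x₀≡y = m≤n+m 1 _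
    ... | inj₂ x₀≢y rewrite Q-clique x₀ y Qx₀ Qy x₀≢y = s≤s z≤n
    at y | false with toSum (z ≟ y)
    ... | inj₂ z≢y rewrite ≢⇒≡ᵇ-false z≢y = z≤n
    ... | inj₁ z≡y rewrite dec-true (z ≟ y) z≡y
                         | subst (λ t → adj H x₀ t ≡ true) z≡y (trans (Graph.sym H x₀ z) (Q⊆N x₀ Qx₀))
                         = s≤s z≤n

  -- β has no odd colour at all, so the neighbour β of w forbids nothing.
  repair-via-few : 2 ≤ ℓ → ∀ β → C β ≡ true → oddAt H φ β ≡ false →
    ∀ w → C w ≡ true → oddAt H φ w ≡ true → oddCount w ≤ 2 → OddColouring K H
  repair-via-few ℓ≥2 β Cβ bad w Cw odd-w few =
    let b , free = count<n⇒false forbidden cost in move-repairs C proper C-clique Cw odd-w odd-outside b free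
    where
    open Move H φ w
    w≢β : w ≢ β
    w≢β refl = true≢false (trans (sym odd-w) bad)
    cheap : ∀ y → ⁅ β ⁆ y ≡ true → count (exactlyPair (oddColours (adj H y) φ) (φ w)) ≡ 0
    cheap y βy rewrite sym (≡ᵇ-true⇒≡ β y βy) =
      count-exactlyPair-absent (oddColours (adj H β) φ) (φ w) (no-odd-colour β bad (φ w))
    β-only : count (λ y → adj H w y ∧ ⁅ β ⁆ y) ≡ 1
    β-only = count-single _ β (cong₂ _∧_ (C-clique w β Cw Cβ w≢β) (≡ᵇ-refl β))
               (λ y y≢β → trans (cong (adj H w y ∧_) (≢⇒≡ᵇ-false (≢-sym y≢β))) (∧-zeroʳ _))
    cost : count forbidden < K
    cost = cost-few count-forbidden (count-used-odd (adj H w) φ) few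
             (subst (λ k → _ + k ≤ degree H w) β-only (count-pairedAt ⁅ β ⁆ cheap))
             (maximum w) (budget⇒3d+3≤2K ℓ≥2 budget)

  -- Otherwise every odd vertex of C has three odd colours, so no vertex of C can be paired with x₀.
  repair-via-x₀ : (∀ w → C w ≡ true → oddAt H φ w ≡ true → 3 ≤ oddCount w) → OddColouring K H
  repair-via-x₀ many =
    let b , free = count<n⇒false forbidden cost in move-repairs C proper C-clique Cx₀ odd-x₀ odd-outside b free
    where
    open Move H φ x₀
    cheap : ∀ y → C y ≡ true → count (exactlyPair (oddColours (adj H y) φ) (φ x₀)) ≡ 0
    cheap y Cy with oddAt H φ y in odd-y
    ... | true  = count-exactlyPair-many (oddColours (adj H y) φ) (φ x₀) (many y Cy odd-y)
    ... | false = count-exactlyPair-absent (oddColours (adj H y) φ) (φ x₀) (no-odd-colour y odd-y (φ x₀))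
    cost : count forbidden < K
    cost = below-budget {d = d} (begin
      count forbidden + count Q
        ≤⟨ +-monoˡ-≤ (count Q) count-forbidden ⟩
      count (used (adj H x₀) φ) + (1 + T) + count Q
        ≤⟨ +-monoˡ-≤ (count Q) (+-monoˡ-≤ (1 + T) (≤-trans (count-used (adj H x₀) φ) (maximum x₀))) ⟩
      d + (1 + T) + count Q
        ≡⟨ regroup d T (count Q) ⟩
      d + 1 + (T + count Q)
        ≤⟨ +-monoʳ-≤ (d + 1) (≤-trans (+-monoʳ-≤ T Q≤N∩C)
                                      (≤-trans (count-pairedAt C cheap) (maximum x₀))) ⟩
      d + 1 + d
        ≡⟨ regroup′ d ⟩
      d + d + 1 ∎) (budget (count Q) d≤ℓ|Q|)
      where
      open ≤-Reasoning
      T : ℕ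
      T = sum (λ y → count (pairedAt y))
      regroup : ∀ d T q → d + (1 + T) + q ≡ d + 1 + (T + q)
      regroup = solve-∀
      regroup′ : ∀ d → d + 1 + d ≡ d + d + 1
      regroup′ = solve-∀

  bad⇒C : ∀ y → oddAt H φ y ≢ true → C y ≡ true
  bad⇒C y bad = ¬-not λ Cy → bad (odd-outside y Cy)

  result : OddColouring K H
  result with ℓ ≤? 1
  ... | yes ℓ≤1 = φ , proper , λ v → neighbourhood-clique⇒oddAt H φ v
                    (lcc≤1⇒neighbourhood-clique H (subst (LccAtMost H) (≤-antisym ℓ≤1 ℓ≥1) cover) v) proper
  ... | no ℓ≰1 with all? (λ v → oddAt H φ v ≟ᴮ true)
  ...   | yes all-odd = φ , proper , all-odd
  ...   | no not-all with ¬∀⟶∃¬ n _ (λ v → oddAt H φ v ≟ᴮ true) not-all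
  ...     | β , bad with any? (λ w → (C w ≟ᴮ true) ×-dec (oddAt H φ w ≟ᴮ true) ×-dec (oddCount w ≤? 2))
  ...       | yes (w , Cw , odd-w , few) = repair-via-few (≰⇒> ℓ≰1) β (bad⇒C β bad) (¬-not bad) w Cw odd-w few
  ...       | no none = repair-via-x₀ (λ w Cw odd-w → ≰⇒> λ few → none (w , Cw , odd-w , few))

edgeless-oddColouring : ∀ {n K} (H : Graph n) → Fin K → (∀ v → ¬ 1 ≤ degree H v) → OddColouring K H
edgeless-oddColouring H c edgeless = (λ _ → c) , no-edges , isolated-everywhere
  where
  no-edges : Proper H (λ _ → c)
  no-edges u v uv =
    ⊥-elim (edgeless u (≤-trans (≤-reflexive (cong 𝟙 (sym uv))) (sum-≤-term (λ w → 𝟙 (adj H u w)) v)))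
  isolated-everywhere : ∀ v → oddAt H (λ _ → c) v ≡ true
  isolated-everywhere v with anyᵇ (adj H v) in nonisolated
  ... | false = refl
  ... | true  =
    ⊥-elim (edgeless v (≤-trans (≤-reflexive (cong 𝟙 (sym nonisolated))) (𝟙-anyᵇ≤count (adj H v))))

module _ {ℓ K D : ℕ} (ℓ≥1 : 1 ≤ ℓ) (budget : Budget ℓ K D) where

  oddColouring : ∀ {n} (H : Graph n) → LccAtMost H ℓ → (∀ v → degree H v ≤ D) → OddColouring K H
  oddColouring {n} = All.wfRec (On.wellFounded edges <-wellFounded) 0ℓ P step
    where
    P : Graph n → Set
    P H = LccAtMost H ℓ → (∀ v → degree H v ≤ D) → OddColouring K H
    colour : Fin K
    colour = fromℕ< (≤-trans (s≤s z≤n) (budget⇒2≤K ℓ≥1 budget))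
    step : ∀ H → (∀ {H′} → edges H′ < edges H → P H′) → P H
    step H smaller cover bounded with any? (λ v → 1 ≤? degree H v)
    ... | no  edgeless     = edgeless-oddColouring H colour (λ v pos → edgeless (v , pos))
    ... | yes (v , pos) =
      let z , maximum = argmax (degree H) v
          nonisolated = ≤-trans pos (maximum v)
          φ′ , proper′ , odd′ = smaller {isolate H z} (edges-isolate H z nonisolated) (lcc-isolate H z cover)
                                  (λ u → ≤-trans (degree-isolate H z u) (bounded u))
      in Step.result H z cover ℓ≥1 maximum nonisolated (budget-mono ℓ≥1 (bounded z) budget) φ′ proper′ odd′

length-filterᵇ-tabulate : ∀ {A : Set} {n} (p : A → Bool) (f : Fin n → A) →
                          length (filterᵇ p (tabulate f)) ≡ count (λ i → p (f i))
length-filterᵇ-tabulate {n = zero}  p f = refl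
length-filterᵇ-tabulate {n = suc n} p f with p (f zero)
... | true  = cong suc (length-filterᵇ-tabulate p (λ i → f (suc i)))
... | false = length-filterᵇ-tabulate p (λ i → f (suc i))

filterᵇ-filterᵇ : ∀ {A : Set} (p q : A → Bool) (xs : List A) →
                  filterᵇ p (filterᵇ q xs) ≡ filterᵇ (λ x → q x ∧ p x) xs
filterᵇ-filterᵇ p q []       = refl
filterᵇ-filterᵇ p q (x ∷ xs) with q x
... | false = filterᵇ-filterᵇ p q xs
... | true with p x
...   | true  = cong (x ∷_) (filterᵇ-filterᵇ p q xs)
...   | false = filterᵇ-filterᵇ p q xs

module _ {n : ℕ} (G : Graph n) where

  deg≡degree : ∀ v → deg G v ≡ degree G v
  deg≡degree v = length-filterᵇ-tabulate (adj G v) id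

  degree≤Δ : ∀ v → degree G v ≤ Δ G
  degree≤Δ v = begin
    degree G v                                ≡⟨ deg≡degree v ⟨
    deg G v                                   ≤⟨ ≤-max (deg G) v ⟩
    foldr _⊔_ 0 (tabulate (deg G))            ≡⟨ cong (foldr _⊔_ 0) (map-tabulate id (deg G)) ⟨
    Δ G                                       ∎
    where
    open ≤-Reasoning
    ≤-max : ∀ {m} (f : Fin m → ℕ) i → f i ≤ foldr _⊔_ 0 (tabulate f)
    ≤-max f zero    = m≤m⊔n (f zero) _
    ≤-max f (suc i) = ≤-trans (≤-max (λ j → f (suc j)) i) (m≤n⊔m (f zero) _)

  colourCount≡occ : ∀ {K} (φ : Fin n → Fin K) v a → colourCount G φ v a ≡ occ (adj G v) φ a
  colourCount≡occ φ v a = begin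
    colourCount G φ v a                 ≡⟨ cong length (filterᵇ-filterᵇ _ (adj G v) (allFin n)) ⟩
    length (filterᵇ has-a (allFin n))   ≡⟨ length-filterᵇ-tabulate has-a id ⟩
    count has-a                         ≡⟨ sum-cong-≗ (λ u → cong (λ t → 𝟙 (adj G v u ∧ t))
                                                                (isYes≗does (φ u ≟ a))) ⟩
    occ (adj G v) φ a                   ∎
    where
    open ≡-Reasoning
    has-a : Fin n → Bool
    has-a u = adj G v u ∧ ⌊ φ u ≟ a ⌋

  oddAt⇒IsOddColouring : ∀ {K} (φ : Fin n → Fin K) → Proper G φ → (∀ v → oddAt G φ v ≡ true) →
                         IsOddColouring G φ
  oddAt⇒IsOddColouring {K} φ proper odd = proper , odd-colour
    where
    odd-colour : ∀ v → 0 < deg G v → ∃[ a ] colourCount G φ v a % 2 ≡ 1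
    odd-colour v pos with anyᵇ (adj G v) in nonisolated
    ... | false =
      ⊥-elim (1+n≰n (≤-trans pos (≤-reflexive (trans (deg≡degree v) (count-none (adj G v) nonisolated)))))
    ... | true  = a , trans (cong (_% 2) (colourCount≡occ φ v a)) (odd⇒%2≡1 (occ (adj G v) φ a) odd-a)
      where
      some-odd : anyᵇ (oddColours (adj G v) φ) ≡ true
      some-odd = trans (cong (λ t → not t ∨ anyᵇ (oddColours (adj G v) φ)) (sym nonisolated)) (odd v)
      a : Fin K
      a = proj₁ (anyᵇ-witness (oddColours (adj G v) φ) some-odd)
      odd-a : oddColours (adj G v) φ a ≡ true
      odd-a = proj₂ (anyᵇ-witness (oddColours (adj G v) φ) some-odd)

theorem1p6 : (ℓ : ℕ) → 0 < ℓ → (n : ℕ) → (G : Graph n) → LccAtMost G ℓ →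
    ∃[ k ] (Σ (Fin n → Fin k) (IsOddColouring G) × ℓ * k ≤ (2 * ℓ ∸ 1) * Δ G + 2 * ℓ)
theorem1p6 ℓ ℓ>0 n G cover =
  let s , Δ≤ℓs , least = least-multiple ℓ (Δ G) ℓ>0
      φ , proper , odd = oddColouring ℓ>0 (initial-budget ℓ>0 Δ≤ℓs least) G cover (degree≤Δ G)
  in Δ G + Δ G + 2 ∸ s , (φ , oddAt⇒IsOddColouring G φ proper odd) , colour-bound ℓ>0 Δ≤ℓs least
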